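{- Let $H$ be an abelian group in which there is a border tricolored sum-free set of cardinality $\lvert M\rvert$ and range $t$. Then for each positive integer $N$ there exists a tricolored sum-free set in $H^N$ of cardinality at least $\lvert M\rvert^N/(2Nt+1)^3$.
   Context: $H$ is written additively. A tricolored sum-free set in $H$ is a set $M\subseteq S\times T\times U$, $S,T,U\subseteq H$, that is a 3-dimensional perfect matching on $S\times T\times U$ (each coordinate projection is a bijection onto $S$, $T$, $U$ respectively) with $s+t+u=0$ for all $(s,t,u)\in M$ and $s+t+u\neq0$ for all $(s,t,u)\in(S\times T\times U)\setminus M$; its cardinality is $\lvert M\rvert$. A border tricolored sum-free set is such a perfect matching $M\subseteq S\times T\times U$ together with functions $\alpha:S\to\mathbb{Z}$, $\beta:T\to\mathbb{Z}$, $\gamma:U\to\mathbb{Z}$ with $s+t+u=0$ and $\alpha(s)+\beta(t)+\gamma(u)=0$ for all $(s,t,u)\in M$, and, for all $(s,t,u)\in(S\times T\times U)\setminus M$, either $s+t+u\neq 0$ or $\alpha(s)+\beta(t)+\gamma(u)>0$. Its cardinality is $\lvert M\rvert$ and its range is the maximum of $\lvert\alpha(s)\rvert,\lvert\beta(t)\rvert,\lvert\gamma(u)\rvert$ over $s\in S,t\in T,u\in U$. -}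

module Defs where

open import Level using (Level; _⊔_)
open import Algebra.Bundles using (AbelianGroup)
open import Data.Nat as ℕ using (ℕ; zero; suc)
open import Data.Fin using (Fin; zero; suc)
open import Data.Integer as ℤ using (ℤ; ∣_∣)
open import Data.Product using (_×_; Σ; ∃; _,_)
open import Data.Sum using (_⊎_)
open import Relation.Binary.PropositionalEquality using (_≡_)
open import Relation.Nullary using (¬_)

maxOver : {m : ℕ} → (Fin m → ℕ) → ℕ
maxOver {zero} f = 0
maxOver {suc m} f = f zero ℕ.⊔ maxOver (λ i → f (suc i))

-- "not all three indices equal", i.e. (s_i, t_j, u_k) is not a triple of M
NotDiag : {m : ℕ} → Fin m → Fin m → Fin m → Set
NotDiag i j k = ¬ (i ≡ j × j ≡ k)

module _ {c ℓ : Level} (H : AbelianGroup c ℓ) where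
  open AbelianGroup H renaming (Carrier to G)

  -- A perfect matching M ⊆ S × T × U of size m is given by listing it:
  -- M = { (s i , t i , u i) | i : Fin m } with s, t, u injective, and
  -- S, T, U the images of s, t, u (then each projection is a bijection).
  record TricoloredSumFree (m : ℕ) : Set (c ⊔ ℓ) where
    field
      s t u  : Fin m → G
      s-inj  : ∀ i j → s i ≈ s j → i ≡ j
      t-inj  : ∀ i j → t i ≈ t j → i ≡ j
      u-inj  : ∀ i j → u i ≈ u j → i ≡ j
      onM    : ∀ i → (s i ∙ t i) ∙ u i ≈ ε
      offM   : ∀ i j k → NotDiag i j k → ¬ ((s i ∙ t j) ∙ u k ≈ ε)

  record BorderTricoloredSumFree (m : ℕ) : Set (c ⊔ ℓ) where
    field
      s t u  : Fin m → G
      s-inj  : ∀ i j → s i ≈ s j → i ≡ j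
      t-inj  : ∀ i j → t i ≈ t j → i ≡ j
      u-inj  : ∀ i j → u i ≈ u j → i ≡ j
      -- α, β, γ as functions on S, T, U, i.e. on the indices
      α β γ  : Fin m → ℤ
      onM    : ∀ i → (s i ∙ t i) ∙ u i ≈ ε
      onMw   : ∀ i → (α i ℤ.+ β i) ℤ.+ γ i ≡ ℤ.0ℤ
      offM   : ∀ i j k → NotDiag i j k →
               ¬ ((s i ∙ t j) ∙ u k ≈ ε) ⊎ (ℤ.0ℤ ℤ.< (α i ℤ.+ β j) ℤ.+ γ k)

    range : ℕ
    range = maxOver (λ i → (∣ α i ∣ ℕ.⊔ ∣ β i ∣) ℕ.⊔ ∣ γ i ∣)

power : {c ℓ : Level} → AbelianGroup c ℓ → ℕ → AbelianGroup c ℓ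
power H N = record
  { Carrier = Fin N → G
  ; _≈_ = λ x y → ∀ n → x n ≈ y n
  ; _∙_ = λ x y n → x n ∙ y n
  ; ε = λ _ → ε
  ; _⁻¹ = λ x n → x n ⁻¹
  ; isAbelianGroup = record
    { isGroup = record
      { isMonoid = record
        { isSemigroup = record
          { isMagma = record
            { isEquivalence = record
              { refl = λ n → refl
              ; sym = λ p n → sym (p n)
              ; trans = λ p q n → trans (p n) (q n) }
            ; ∙-cong = λ p q n → ∙-cong (p n) (q n) }
          ; assoc = λ x y z n → assoc (x n) (y n) (z n) }
        ; identity = (λ x n → identityˡ (x n)) , (λ x n → identityʳ (x n)) }
      ; inverse = (λ x n → inverseˡ (x n)) , (λ x n → inverseʳ (x n))
      ; ⁻¹-cong = λ p n → ⁻¹-cong (p n) }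
    ; comm = λ x y n → comm (x n) (y n) } }
  where open AbelianGroup H renaming (Carrier to G)

module Submission where

-- Index the N-th power of M by vectors v ∈ (Fin m)^N; the triple of v is
-- (s v, t v, u v) taken coordinatewise, and v carries the summed weights
-- A v = Σₙ α (vₙ), B v = Σₙ β (vₙ), C v = Σₙ γ (vₙ).
--   * Summing the border condition over coordinates: if three vectors v, w, z
--     give a zero sum in H^N, then either v = w = z or the total weight
--     A v + B w + C z is strictly positive.
--   * Restricted to a level set {A = a, B = b} the total weight of any triple
--     is a + b + C z = A z + B z + C z = 0, so on a level set only the
--     diagonal triples sum to zero: a level set is a tricolored sum-free set.
--   * A and B take at most 2Nt + 1 values, so pigeonholing twice yields a
--     level set with at least m^N / (2Nt + 1)^2 ≥ m^N / (2Nt + 1)^3 elements.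

open import Defs
open import Level using (Level)
open import Algebra.Bundles using (AbelianGroup)
open import Data.Nat using (ℕ; _*_; _+_; _^_; _≤_)
open import Data.Product using (Σ)
open import Relation.Binary.PropositionalEquality using (_≡_)

open import Data.Nat as ℕ using (zero; suc; _<_; z≤n; s≤s; _⊔_)
import Data.Nat.Properties as ℕP
open import Data.Nat.Tactic.RingSolver using () renaming (solve-∀ to ℕ-solve)
open import Data.Integer as ℤ using (ℤ; ∣_∣; +_; -[1+_]; 0ℤ)
  renaming (_+_ to _+ᶻ_; _<_ to _<ᶻ_)
import Data.Integer.Properties as ℤP
open import Data.Integer.Tactic.RingSolver using () renaming (solve-∀ to ℤ-solve)
open import Data.Fin as Fin using (Fin; zero; suc)
open import Data.Vec as Vec using (Vec; []; _∷_; lookup)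
import Data.Vec.Properties as VecP
open import Data.List as List
  using (List; []; _∷_; length; filter; map; allFin; cartesianProductWith)
open import Data.Nat.ListAction using (sum)
import Data.List.Properties as ListP
open import Data.List.Membership.Propositional using (_∈_)
open import Data.List.Membership.Propositional.Properties using (∈-lookup; ∈-filter⁻)
open import Data.List.Relation.Unary.Any using (here; there)
import Data.List.Relation.Unary.All as All
open import Data.List.Relation.Unary.AllPairs using ([]; _∷_)
open import Data.List.Relation.Unary.Unique.Propositional using (Unique)
import Data.List.Relation.Unary.Unique.Propositional.Properties as Unique
open import Data.Product using (_×_; _,_; ∃; proj₁; proj₂; map₁)
open import Data.Sum using (_⊎_; inj₁; inj₂) renaming (map₁ to ⊎-map₁)
open import Data.Empty using (⊥-elim)
open import Function using (_∘_)
open import Relation.Nullary using (¬_; yes; no)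
open import Relation.Binary.PropositionalEquality
  using (refl; sym; trans; cong; cong₂; subst; module ≡-Reasoning)

maxOver-≤ : ∀ {m} (f : Fin m → ℕ) i → f i ≤ maxOver f
maxOver-≤ f zero    = ℕP.m≤m⊔n _ _
maxOver-≤ f (suc i) = ℕP.≤-trans (maxOver-≤ (f ∘ suc) i) (ℕP.m≤n⊔m _ _)

Unique-lookup-injective : ∀ {A : Set} {xs : List A} → Unique xs →
  ∀ i j → List.lookup xs i ≡ List.lookup xs j → i ≡ j
Unique-lookup-injective (_ ∷ _) zero zero _ = refl
Unique-lookup-injective (x∉ ∷ _) zero (suc j) eq = ⊥-elim (All.lookup x∉ (∈-lookup j) eq)
Unique-lookup-injective (x∉ ∷ _) (suc i) zero eq = ⊥-elim (All.lookup x∉ (∈-lookup i) (sym eq))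
Unique-lookup-injective (_ ∷ u) (suc i) (suc j) eq = cong suc (Unique-lookup-injective u i j eq)

length-cartesianProductWith : ∀ {A B C : Set} (f : A → B → C) xs ys →
  length (cartesianProductWith f xs ys) ≡ length xs * length ys
length-cartesianProductWith f [] ys = refl
length-cartesianProductWith f (x ∷ xs) ys =
  trans (ListP.length-++ (map (f x) ys))
        (cong₂ _+_ (ListP.length-map (f x) ys) (length-cartesianProductWith f xs ys))

allVecs : (m N : ℕ) → List (Vec (Fin m) N)
allVecs m zero    = [] ∷ []
allVecs m (suc N) = cartesianProductWith _∷_ (allFin m) (allVecs m N)

allVecs-length : ∀ m N → length (allVecs m N) ≡ m ^ N
allVecs-length m zero    = refl
allVecs-length m (suc N) =
  trans (length-cartesianProductWith _∷_ (allFin m) (allVecs m N))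
        (cong₂ _*_ {y = m} (ListP.length-tabulate (λ i → i)) (allVecs-length m N))

allVecs-unique : ∀ m N → Unique (allVecs m N)
allVecs-unique m zero    = All.[] ∷ []
allVecs-unique m (suc N) =
  Unique.cartesianProductWith⁺ _∷_ VecP.∷-injective (Unique.allFin⁺ m) (allVecs-unique m N)

symRange : ℕ → List ℤ
symRange zero    = 0ℤ ∷ []
symRange (suc R) = -[1+ R ] ∷ + suc R ∷ symRange R

symRange-length : ∀ R → length (symRange R) ≡ 2 * R + 1
symRange-length zero    = refl
symRange-length (suc R) =
  trans (cong (λ n → 2 + n) (symRange-length R)) (cong (_+ 1) (sym (ℕP.*-suc 2 R)))

symRange-complete : ∀ R x → ∣ x ∣ ≤ R → x ∈ symRange R
symRange-complete zero (+ zero) _ = here refl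
symRange-complete (suc R) (+ n) ∣x∣≤ with n ℕ.≟ suc R
... | yes refl = there (here refl)
... | no n≢ = there (there (symRange-complete R (+ n) (ℕP.≤-pred (ℕP.≤∧≢⇒< ∣x∣≤ n≢))))
symRange-complete (suc R) -[1+ n ] ∣x∣≤ with n ℕ.≟ R
... | yes refl = here refl
... | no n≢ = there (there (symRange-complete R -[1+ n ] (ℕP.≤∧≢⇒< (ℕP.≤-pred ∣x∣≤) n≢)))

module _ {B : Set} where
  sum-mono : (f g : B → ℕ) → (∀ a → f a ≤ g a) → ∀ Ks → sum (map f Ks) ≤ sum (map g Ks)
  sum-mono f g f≤g []       = ℕP.≤-refl
  sum-mono f g f≤g (k ∷ Ks) = ℕP.+-mono-≤ (f≤g k) (sum-mono f g f≤g Ks)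

  sum-strictMono : (f g : B → ℕ) → (∀ a → f a ≤ g a) → ∀ {a₀} Ks → a₀ ∈ Ks →
    f a₀ < g a₀ → sum (map f Ks) < sum (map g Ks)
  sum-strictMono f g f≤g (k ∷ Ks) (here refl) lt = ℕP.+-mono-<-≤ lt (sum-mono f g f≤g Ks)
  sum-strictMono f g f≤g (k ∷ Ks) (there a₀∈) lt =
    ℕP.+-mono-≤-< (f≤g k) (sum-strictMono f g f≤g Ks a₀∈ lt)

  sum-≤-length*max : (a₀ : B) (f : B → ℕ) → ∀ Ks → ∃ λ a → sum (map f Ks) ≤ length Ks * f a
  sum-≤-length*max a₀ f [] = a₀ , z≤n
  sum-≤-length*max a₀ f (k ∷ Ks) with sum-≤-length*max a₀ f Ks
  ... | a , sum≤ with f k ℕ.≤? f a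
  ... | yes fk≤fa = a , ℕP.+-mono-≤ fk≤fa sum≤
  ... | no fk≰fa = k , ℕP.+-mono-≤ ℕP.≤-refl (ℕP.≤-trans sum≤
                     (ℕP.*-monoʳ-≤ (length Ks) (ℕP.<⇒≤ (ℕP.≰⇒> fk≰fa))))

module Pigeonhole {A : Set} (key : A → ℤ) where
  fibre : ℤ → List A → List A
  fibre a = filter (λ x → key x ℤ.≟ a)

  fibre-∷ : ∀ a x L → length (fibre a L) ≤ length (fibre a (x ∷ L))
  fibre-∷ a x L with key x ℤ.≟ a
  ... | yes _ = ℕP.n≤1+n _
  ... | no _  = ℕP.≤-refl

  fibre-∷-own : ∀ x L → length (fibre (key x) L) < length (fibre (key x) (x ∷ L))
  fibre-∷-own x L with key x ℤ.≟ key x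
  ... | yes _ = ℕP.≤-refl
  ... | no ≢  = ⊥-elim (≢ refl)

  length-≤-sumFibres : ∀ Ks → (∀ x → key x ∈ Ks) → ∀ L →
    length L ≤ sum (map (λ a → length (fibre a L)) Ks)
  length-≤-sumFibres Ks keys [] = z≤n
  length-≤-sumFibres Ks keys (x ∷ L) =
    ℕP.≤-trans (s≤s (length-≤-sumFibres Ks keys L))
      (sum-strictMono _ _ (λ a → fibre-∷ a x L) Ks (keys x) (fibre-∷-own x L))

  pigeonhole : ∀ R → (∀ x → ∣ key x ∣ ≤ R) → ∀ L →
    ∃ λ a → length L ≤ (2 * R + 1) * length (fibre a L)
  pigeonhole R bounded L with sum-≤-length*max 0ℤ (λ a → length (fibre a L)) (symRange R)
  ... | a , sum≤ = a , ℕP.≤-trans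
        (length-≤-sumFibres (symRange R) (λ x → symRange-complete R (key x) (bounded x)) L)
        (subst (λ q → sum (map (λ a → length (fibre a L)) (symRange R)) ≤ q * length (fibre a L))
               (symRange-length R) sum≤)

Settled : Set → ℤ → Set
Settled P e = (P × e ≡ 0ℤ) ⊎ (0ℤ <ᶻ e)

settled-+ : ∀ {P Q a b} → Settled P a → Settled Q b → Settled (P × Q) (a +ᶻ b)
settled-+ (inj₁ (p , refl)) (inj₁ (q , refl)) = inj₁ ((p , q) , refl)
settled-+ (inj₁ (_ , refl)) (inj₂ b>0) = inj₂ (subst (0ℤ <ᶻ_) (sym (ℤP.+-identityˡ _)) b>0)
settled-+ (inj₂ a>0) (inj₁ (_ , refl)) = inj₂ (subst (0ℤ <ᶻ_) (sym (ℤP.+-identityʳ _)) a>0)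
settled-+ (inj₂ a>0) (inj₂ b>0) = inj₂ (ℤP.+-mono-<-≤ a>0 (ℤP.<⇒≤ b>0))

+-interchange₃ : ∀ a b c x y z →
  ((a +ᶻ x) +ᶻ (b +ᶻ y)) +ᶻ (c +ᶻ z) ≡ ((a +ᶻ b) +ᶻ c) +ᶻ ((x +ᶻ y) +ᶻ z)
+-interchange₃ = ℤ-solve

module Power {c ℓ : Level} (H : AbelianGroup c ℓ) {m : ℕ}
             (M : BorderTricoloredSumFree H m) where
  open AbelianGroup H using (_≈_; _∙_; ε) renaming (Carrier to G)
  open BorderTricoloredSumFree M

  weight : ∀ {N} → (Fin m → ℤ) → Vec (Fin m) N → ℤ
  weight f []      = 0ℤ
  weight f (x ∷ v) = f x +ᶻ weight f v

  weight-bound : ∀ f r → (∀ x → ∣ f x ∣ ≤ r) → ∀ {N} (v : Vec (Fin m) N) → ∣ weight f v ∣ ≤ N * r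
  weight-bound f r bound []      = z≤n
  weight-bound f r bound (x ∷ v) = ℕP.≤-trans (ℤP.∣i+j∣≤∣i∣+∣j∣ (f x) (weight f v))
                                     (ℕP.+-mono-≤ (bound x) (weight-bound f r bound v))

  excess : Fin m → Fin m → Fin m → ℤ
  excess x y k = (α x +ᶻ β y) +ᶻ γ k

  excessᴺ : ∀ {N} → Vec (Fin m) N → Vec (Fin m) N → Vec (Fin m) N → ℤ
  excessᴺ v w z = (weight α v +ᶻ weight β w) +ᶻ weight γ z

  excessᴺ-∷ : ∀ {N} x y k (v w z : Vec (Fin m) N) →
    excessᴺ (x ∷ v) (y ∷ w) (k ∷ z) ≡ excess x y k +ᶻ excessᴺ v w z
  excessᴺ-∷ x y k v w z = +-interchange₃ (α x) (β y) (γ k) (weight α v) (weight β w) (weight γ z)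

  excessᴺ-diagonal : ∀ {N} (v : Vec (Fin m) N) → excessᴺ v v v ≡ 0ℤ
  excessᴺ-diagonal []      = refl
  excessᴺ-diagonal (x ∷ v) =
    trans (excessᴺ-∷ x x x v v v) (cong₂ _+ᶻ_ (onMw x) (excessᴺ-diagonal v))

  offDiagonal-positive : ∀ x y k → NotDiag x y k → (s x ∙ t y) ∙ u k ≈ ε → 0ℤ <ᶻ excess x y k
  offDiagonal-positive x y k notDiag zero-sum with offM x y k notDiag
  ... | inj₁ nonzero = ⊥-elim (nonzero zero-sum)
  ... | inj₂ pos     = pos

  excess-settled : ∀ x y k → (s x ∙ t y) ∙ u k ≈ ε → Settled (x ≡ y × y ≡ k) (excess x y k)
  excess-settled x y k zero-sum with x Fin.≟ y | y Fin.≟ k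
  ... | yes refl | yes refl = inj₁ ((refl , refl) , onMw x)
  ... | no x≢y   | _        = inj₂ (offDiagonal-positive x y k (x≢y ∘ proj₁) zero-sum)
  ... | yes _    | no y≢k   = inj₂ (offDiagonal-positive x y k (y≢k ∘ proj₂) zero-sum)

  excessᴺ-settled : ∀ {N} (v w z : Vec (Fin m) N) →
    (∀ n → (s (lookup v n) ∙ t (lookup w n)) ∙ u (lookup z n) ≈ ε) →
    Settled (v ≡ w × w ≡ z) (excessᴺ v w z)
  excessᴺ-settled [] [] [] _ = inj₁ ((refl , refl) , refl)
  excessᴺ-settled (x ∷ v) (y ∷ w) (k ∷ z) zero-sum =
    subst (Settled _) (sym (excessᴺ-∷ x y k v w z))
      (⊎-map₁ (map₁ diagonal)
        (settled-+ (excess-settled x y k (zero-sum zero))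
                   (excessᴺ-settled v w z (zero-sum ∘ suc))))
    where
    diagonal : (x ≡ y × y ≡ k) × (v ≡ w × w ≡ z) → x ∷ v ≡ y ∷ w × y ∷ w ≡ k ∷ z
    diagonal ((x≡y , y≡k) , (v≡w , w≡z)) = cong₂ _∷_ x≡y v≡w , cong₂ _∷_ y≡k w≡z

  levelSet-sumFree : ∀ {N k} (e : Fin k → Vec (Fin m) N) → (∀ i j → e i ≡ e j → i ≡ j) →
    ∀ a b → (∀ i → weight α (e i) ≡ a) → (∀ i → weight β (e i) ≡ b) →
    TricoloredSumFree (power H N) k
  levelSet-sumFree e e-inj a b levelα levelβ = record
    { s = λ i n → s (lookup (e i) n)
    ; t = λ i n → t (lookup (e i) n)
    ; u = λ i n → u (lookup (e i) n)
    ; s-inj = coordinatewise-injective s s-inj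
    ; t-inj = coordinatewise-injective t t-inj
    ; u-inj = coordinatewise-injective u u-inj
    ; onM = λ i n → onM (lookup (e i) n)
    ; offM = λ i j l notDiag zero-sum →
        offDiagonal i j l notDiag (excessᴺ-settled (e i) (e j) (e l) zero-sum)
    }
    where
    coordinatewise-injective : (f : Fin m → G) → (∀ x y → f x ≈ f y → x ≡ y) →
      ∀ i j → (∀ n → f (lookup (e i) n) ≈ f (lookup (e j) n)) → i ≡ j
    coordinatewise-injective f f-inj i j same = e-inj i j (begin
      e i                      ≡⟨ sym (VecP.tabulate∘lookup (e i)) ⟩
      Vec.tabulate (lookup (e i)) ≡⟨ VecP.tabulate-cong (λ n → f-inj _ _ (same n)) ⟩
      Vec.tabulate (lookup (e j)) ≡⟨ VecP.tabulate∘lookup (e j) ⟩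
      e j                      ∎)
      where open ≡-Reasoning

    excessᴺ-level : ∀ i j l → excessᴺ (e i) (e j) (e l) ≡ 0ℤ
    excessᴺ-level i j l = begin
      (weight α (e i) +ᶻ weight β (e j)) +ᶻ weight γ (e l)
        ≡⟨ cong (λ q → q +ᶻ weight γ (e l))
             (cong₂ _+ᶻ_ (trans (levelα i) (sym (levelα l))) (trans (levelβ j) (sym (levelβ l)))) ⟩
      excessᴺ (e l) (e l) (e l)
        ≡⟨ excessᴺ-diagonal (e l) ⟩
      0ℤ ∎
      where open ≡-Reasoning

    offDiagonal : ∀ i j l → NotDiag i j l → ¬ Settled (e i ≡ e j × e j ≡ e l) (excessᴺ (e i) (e j) (e l))
    offDiagonal i j l notDiag (inj₁ ((eᵢ≡eⱼ , eⱼ≡eₗ) , _)) = notDiag (e-inj i j eᵢ≡eⱼ , e-inj j l eⱼ≡eₗ)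
    offDiagonal i j l notDiag (inj₂ pos) = ℤP.<-irrefl refl (subst (0ℤ <ᶻ_) (excessᴺ-level i j l) pos)

  α-bound : ∀ x → ∣ α x ∣ ≤ range
  α-bound x = ℕP.≤-trans (ℕP.≤-trans (ℕP.m≤m⊔n ∣ α x ∣ ∣ β x ∣) (ℕP.m≤m⊔n _ ∣ γ x ∣))
                (maxOver-≤ (λ i → (∣ α i ∣ ⊔ ∣ β i ∣) ⊔ ∣ γ i ∣) x)

  β-bound : ∀ x → ∣ β x ∣ ≤ range
  β-bound x = ℕP.≤-trans (ℕP.≤-trans (ℕP.m≤n⊔m ∣ α x ∣ ∣ β x ∣) (ℕP.m≤m⊔n _ ∣ γ x ∣))
                (maxOver-≤ (λ i → (∣ α i ∣ ⊔ ∣ β i ∣) ⊔ ∣ γ i ∣) x)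

  largeLevelSet : ∀ N → ∃ λ (L : List (Vec (Fin m) N)) → Unique L × ∃ λ a → ∃ λ b →
    (∀ i → weight α (List.lookup L i) ≡ a) × (∀ i → weight β (List.lookup L i) ≡ b) ×
    m ^ N ≤ (2 * N * range + 1) * ((2 * N * range + 1) * length L)
  largeLevelSet N =
    L₂ , Unique.filter⁺ isB (Unique.filter⁺ isA (allVecs-unique m N)) , a , b ,
    (λ i → proj₂ (∈-filter⁻ isA {xs = L₀} (proj₁ (∈-filter⁻ isB {xs = L₁} (∈-lookup i))))) ,
    (λ i → proj₂ (∈-filter⁻ isB {xs = L₁} (∈-lookup i))) ,
    subst (λ q → m ^ N ≤ q * (q * length L₂)) (cong (_+ 1) (sym (ℕP.*-assoc 2 N range)))
      (ℕP.≤-trans (ℕP.≤-reflexive (sym (allVecs-length m N)))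
        (ℕP.≤-trans |L₀|≤ (ℕP.*-monoʳ-≤ (2 * (N * range) + 1) |L₁|≤)))
    where
    L₀ = allVecs m N
    pigeonα = Pigeonhole.pigeonhole (weight α) (N * range) (weight-bound α range α-bound) L₀
    a = proj₁ pigeonα
    |L₀|≤ = proj₂ pigeonα
    isA = λ (v : Vec (Fin m) N) → weight α v ℤ.≟ a
    L₁ = filter isA L₀
    pigeonβ = Pigeonhole.pigeonhole (weight β) (N * range) (weight-bound β range β-bound) L₁
    b = proj₁ pigeonβ
    |L₁|≤ = proj₂ pigeonβ
    isB = λ (v : Vec (Fin m) N) → weight β v ℤ.≟ b
    L₂ = filter isB L₁

square-≤-cube : ∀ q k → q * (q * k) ≤ k * q ^ 3
square-≤-cube zero    k = z≤n
square-≤-cube (suc q) k = ℕP.≤-trans (ℕP.m≤m*n (suc q * (suc q * k)) (suc q))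
                                     (ℕP.≤-reflexive (rearrange (suc q) k))
  where
  -- q ^ 3 unfolds definitionally to q * (q * (q * 1))
  rearrange : ∀ q k → (q * (q * k)) * q ≡ k * (q * (q * (q * 1)))
  rearrange = ℕ-solve

lemma3p4 : {c ℓ : Level} (H : AbelianGroup c ℓ) (m t : ℕ)
    (B : BorderTricoloredSumFree H m) →
    BorderTricoloredSumFree.range B ≡ t →
    (N : ℕ) → 1 ≤ N →
    Σ ℕ (λ k → Σ (TricoloredSumFree (power H N) k)
    (λ _ → m ^ N ≤ k * ((2 * N * t + 1) ^ 3)))
lemma3p4 H m t B refl N _
  with L , unique , a , b , levelα , levelβ , large ← Power.largeLevelSet H B N =
  length L ,
  Power.levelSet-sumFree H B (List.lookup L) (Unique-lookup-injective unique) a b levelα levelβ ,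
  ℕP.≤-trans large (square-≤-cube (2 * N * t + 1) (length L))
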